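{- For all positive integers $r,k,m$ with $r>k$ and $n=\binom{r}{k}$, there exists an $(r,k)$-colouring $\varphi$ of $K_{n,m}$ such that $\mathrm{tc}(K_{n,m},\varphi)\geq r-k+1$.
   Context: For integers $r\geq k\geq 1$, an $(r,k)$-colouring of a graph $G$ is a function $\varphi:E(G)\to\binom{[r]}{k}$, assigning to each edge a set of exactly $k$ colours from $[r]=\{1,\dots,r\}$. A subgraph $H\subseteq G$ is monochromatic if there is a colour $i$ belonging to $\varphi(e)$ for every $e\in E(H)$. $\mathrm{tc}(G,\varphi)$ is the minimum number of monochromatic trees (a single vertex counts as a tree) whose union covers $V(G)$. $K_{n,m}$ is the complete bipartite graph with parts of sizes $n$ and $m$. -}

module Defs where

open import Data.Nat using (ℕ; zero; suc; _+_)
open import Data.Bool using (Bool; true; false)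
open import Data.Fin using (Fin)
import Data.Fin as F
open import Data.Fin.Subset using (Subset; _∈_; ∣_∣)
open import Data.Sum using (_⊎_; inj₁; inj₂)
open import Data.Product using (_×_; ∃; ∃-syntax; Σ-syntax)
open import Data.Empty using (⊥)
open import Relation.Binary.PropositionalEquality using (_≡_)
open import Relation.Binary.Construct.Closure.ReflexiveTransitive using (Star)

count : ∀ {n} → (Fin n → Bool) → ℕ
count {zero}  f = 0
count {suc n} f with f F.zero
... | true  = suc (count (λ i → f (F.suc i)))
... | false = count (λ i → f (F.suc i))

-- Vertices of K_{n,m}: left part Fin n, right part Fin m.
-- Edges of K_{n,m}: exactly the pairs (a , b) with a : Fin n, b : Fin m.
Vertex : ℕ → ℕ → Set
Vertex n m = Fin n ⊎ Fin m

record Colouring (r k n m : ℕ) : Set where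
  field
    col  : Fin n → Fin m → Subset r
    size : ∀ a b → ∣ col a b ∣ ≡ k
open Colouring public

record Subgraph (n m : ℕ) : Set where
  field
    vL : Fin n → Bool
    vR : Fin m → Bool
    e  : Fin n → Fin m → Bool
    closed : ∀ a b → e a b ≡ true → (vL a ≡ true) × (vR b ≡ true)
open Subgraph public

InV : ∀ {n m} → Subgraph n m → Vertex n m → Set
InV H (inj₁ a) = vL H a ≡ true
InV H (inj₂ b) = vR H b ≡ true

Adj : ∀ {n m} → Subgraph n m → Vertex n m → Vertex n m → Set
Adj H (inj₁ a) (inj₂ b) = e H a b ≡ true
Adj H (inj₂ b) (inj₁ a) = e H a b ≡ true
Adj H (inj₁ _) (inj₁ _) = ⊥
Adj H (inj₂ _) (inj₂ _) = ⊥

numV : ∀ {n m} → Subgraph n m → ℕ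
numV H = count (vL H) + count (vR H)

numE : ∀ {n} {m} → Subgraph n m → ℕ
numE {zero}  H = 0
numE {suc n} {m} H =
  count (e H F.zero) + numE {n} {m} record
    { vL = λ a → vL H (F.suc a) ; vR = vR H ; e = λ a → e H (F.suc a)
    ; closed = λ a b p → closed H (F.suc a) b p }

Connected : ∀ {n m} → Subgraph n m → Set
Connected H = ∀ u v → InV H u → InV H v → Star (Adj H) u v

IsTree : ∀ {n m} → Subgraph n m → Set
IsTree H = (∃[ u ] InV H u) × Connected H × (numE H + 1 ≡ numV H)

Monochromatic : ∀ {r k n m} → Colouring r k n m → Subgraph n m → Set
Monochromatic {r} φ H = ∃[ i ] (∀ a b → e H a b ≡ true → i ∈ col φ a b)

-- tc(K_{n,m}, φ) ≥ s : no family of fewer than s monochromatic trees covers V(K_{n,m}).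
-- Stated as: every covering family of t monochromatic trees has s ≤ t.
TcAtLeast : ∀ {r k n m} → Colouring r k n m → ℕ → Set
TcAtLeast {r} {k} {n} {m} φ s =
  (t : ℕ) (T : Fin t → Subgraph n m) →
  (∀ j → IsTree (T j) × Monochromatic φ (T j)) →
  (∀ (v : Vertex n m) → ∃[ j ] InV (T j) v) →
  s Data.Nat.≤ t

-- Colour the edges at the left vertex indexed by a k-subset S of [r] with exactly the colours
-- of S. A monochromatic tree of colour c then contains only left vertices S with c ∈ S, and a
-- tree without edges is a single vertex; so a cover by t trees yields t "shapes" (colours or
-- single subsets) such that every k-subset contains one of the colours or is one of the subsets.
-- Such a family has at least r - k + 1 members: by induction on r, removing colour 0 either
-- discards a shape mentioning 0, or else the subsets containing 0 are all caught by colours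
-- other than 0, which gives the bound for (k - 1)-subsets of the remaining r - 1 colours.
module Submission where

open import Defs
open import Data.Nat using (ℕ; zero; suc; _+_; _∸_; _<_; _≤_; s≤s)
open import Data.Nat.Combinatorics using (_C_; nCk+nC[k+1]≡[n+1]C[k+1])
open import Data.Product using (∃-syntax; _,_; proj₁; proj₂)
open import Data.Nat.Properties
open import Data.Bool using (true) renaming (_≟_ to _≟ᵇ_)
open import Data.Fin using (Fin; splitAt; join; cast)
import Data.Fin as F
open import Data.Fin.Properties using (splitAt-join; cast-involutive; any?)
open import Data.Fin.Subset using (Subset; ∣_∣; _∈_; ⊥; ⊤; ⁅_⁆; inside; outside)
open import Data.Fin.Subset.Properties using (∉⊥; ∣⊥∣≡0; ∣⊤∣≡n; ∣⁅x⁆∣≡1)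
open import Data.Vec using ([]; _∷_; there)
open import Data.Sum using (_⊎_; inj₁; inj₂)
open import Data.Maybe using (Maybe; just; nothing)
import Data.Maybe.Relation.Unary.Any as MaybeAny
open import Data.List using (List; []; _∷_; length; tabulate; mapMaybe)
open import Data.List.Properties using (length-mapMaybe; length-tabulate)
open import Data.List.Relation.Unary.Any as Any using (Any; here; there)
open import Data.List.Relation.Unary.Any.Properties using (mapMaybe⁺; map⁺; Any-⊎⁻; tabulate⁺)
open import Function using (_∘_)
open import Relation.Nullary using (¬_; Dec; yes; no; contradiction)
open import Relation.Binary.PropositionalEquality
open import Relation.Binary.Construct.Closure.ReflexiveTransitive using (Star; ε; _◅_)

module _ {A B : Set} (f : A → Maybe B) where

  length-mapMaybe-< : ∀ {xs} → Any (λ x → f x ≡ nothing) xs → length (mapMaybe f xs) < length xs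
  length-mapMaybe-< {x ∷ xs} (here fx≡nothing) rewrite fx≡nothing = s≤s (length-mapMaybe f xs)
  length-mapMaybe-< {x ∷ xs} (there p) with f x
  ... | just _  = s≤s (length-mapMaybe-< p)
  ... | nothing = m<n⇒m<1+n (length-mapMaybe-< p)

  Any-mapMaybe : ∀ {P : A → Set} {Q : B → Set} → (∀ {x} → P x → MaybeAny.Any Q (f x)) →
                 ∀ {xs} → Any P xs → Any Q (mapMaybe f xs)
  Any-mapMaybe P⇒Q {xs} = mapMaybe⁺ f xs ∘ map⁺ ∘ Any.map P⇒Q

≡nothing? : ∀ {A : Set} (x : Maybe A) → Dec (x ≡ nothing)
≡nothing? (just _) = no λ ()
≡nothing? nothing  = yes refl

∣p∣≡0⇒p≡⊥ : ∀ {n} (p : Subset n) → ∣ p ∣ ≡ 0 → p ≡ ⊥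
∣p∣≡0⇒p≡⊥ []            _     = refl
∣p∣≡0⇒p≡⊥ (outside ∷ p) ∣p∣≡0 = cong (outside ∷_) (∣p∣≡0⇒p≡⊥ p ∣p∣≡0)

-- How a monochromatic tree meets the left part of the colouring built below: through edges
-- of a colour c it only reaches subsets containing c; without edges it is a single subset X.
Shape : ℕ → Set
Shape r = Fin r ⊎ Subset r

_covers_ : ∀ {r} → Shape r → Subset r → Set
inj₁ c covers S = c ∈ S
inj₂ X covers S = X ≡ S

CoversAll : ∀ {r} → ℕ → List (Shape r) → Set
CoversAll k L = ∀ S → ∣ S ∣ ≡ k → Any (_covers S) L

-- The shape traced on the subsets of the colours 1, …, r; nothing when the shape mentions
-- colour 0, since it then covers no subset avoiding 0.
avoidZero : ∀ {r} → Shape (suc r) → Maybe (Shape r)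
avoidZero (inj₁ F.zero)        = nothing
avoidZero (inj₁ (F.suc c))     = just (inj₁ c)
avoidZero (inj₂ (outside ∷ X)) = just (inj₂ X)
avoidZero (inj₂ (inside ∷ X))  = nothing

avoidZero-outside : ∀ {r} (s : Shape (suc r)) {S} →
                    s covers (outside ∷ S) → MaybeAny.Any (_covers S) (avoidZero s)
avoidZero-outside (inj₁ (F.suc c))     (there c∈S) = MaybeAny.just c∈S
avoidZero-outside (inj₂ (outside ∷ X)) refl        = MaybeAny.just refl

avoidZero-inside : ∀ {r} (s : Shape (suc r)) {S} → s covers (inside ∷ S) →
                   avoidZero s ≡ nothing ⊎ MaybeAny.Any (_covers S) (avoidZero s)
avoidZero-inside (inj₁ F.zero)       _           = inj₁ refl
avoidZero-inside (inj₁ (F.suc c))    (there c∈S) = inj₂ (MaybeAny.just c∈S)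
avoidZero-inside (inj₂ (inside ∷ X)) _           = inj₁ refl

avoidZero-⁅0⁆ : ∀ {r} (s : Shape (suc r)) → s covers ⁅ F.zero ⁆ → avoidZero s ≡ nothing
avoidZero-⁅0⁆ (inj₁ F.zero)       _           = refl
avoidZero-⁅0⁆ (inj₁ (F.suc c))    (there c∈⊥) = contradiction c∈⊥ ∉⊥
avoidZero-⁅0⁆ (inj₂ (inside ∷ X)) _           = refl

module _ {r} {L : List (Shape (suc r))} where

  coversAll-avoidZero : ∀ {k} → CoversAll k L → CoversAll k (mapMaybe avoidZero L)
  coversAll-avoidZero cov S ∣S∣≡k =
    Any-mapMaybe avoidZero (λ {s} → avoidZero-outside s) (cov (outside ∷ S) ∣S∣≡k)

  coversAll-avoidZero-inside : ∀ {k} → ¬ Any (λ s → avoidZero s ≡ nothing) L →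
                               CoversAll (suc k) L → CoversAll k (mapMaybe avoidZero L)
  coversAll-avoidZero-inside noZero cov S ∣S∣≡k
    with Any-⊎⁻ (Any.map (λ {s} → avoidZero-inside s) (cov (inside ∷ S) (cong suc ∣S∣≡k)))
  ... | inj₁ zeroShape = contradiction zeroShape noZero
  ... | inj₂ caught    = mapMaybe⁺ avoidZero L (map⁺ caught)

coversAll⇒≤length+k : ∀ {r k} (L : List (Shape r)) → k < r → CoversAll (suc k) L → r ≤ length L + k
coversAll⇒≤length+k {suc r} {k} L k<1+r cov
  with m<1+n⇒m<n∨m≡n k<1+r | Any.any? (λ s → ≡nothing? (avoidZero s)) L
... | inj₂ refl | _ with cov ⊤ (∣⊤∣≡n (suc r))
...   | here  _ = s≤s (m≤n+m r _)
...   | there _ = s≤s (m≤n+m r _)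
coversAll⇒≤length+k {suc r} {k} L _ cov | inj₁ k<r | yes zeroShape = begin
  suc r                ≤⟨ s≤s (coversAll⇒≤length+k L′ k<r (coversAll-avoidZero cov)) ⟩
  suc (length L′ + k)  ≤⟨ +-monoˡ-≤ k (length-mapMaybe-< avoidZero zeroShape) ⟩
  length L + k         ∎
  where open ≤-Reasoning; L′ = mapMaybe avoidZero L
coversAll⇒≤length+k {suc r} {zero} L _ cov | inj₁ _ | no noZero =
  contradiction (Any.map (λ {s} → avoidZero-⁅0⁆ s) (cov ⁅ F.zero ⁆ (∣⁅x⁆∣≡1 {suc r} F.zero))) noZero
coversAll⇒≤length+k {suc r} {suc k} L _ cov | inj₁ k<r | no noZero = begin
  suc r                  ≤⟨ s≤s (coversAll⇒≤length+k L′ (<⇒≤ k<r) (coversAll-avoidZero-inside noZero cov)) ⟩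
  suc (length L′ + k)    ≤⟨ s≤s (+-monoˡ-≤ k (length-mapMaybe avoidZero L)) ⟩
  suc (length L + k)     ≡⟨ +-suc (length L) k ⟨
  length L + suc k       ∎
  where open ≤-Reasoning; L′ = mapMaybe avoidZero L

pascal : ∀ r k → suc r C suc k ≡ r C k + r C suc k
pascal r k = sym (nCk+nC[k+1]≡[n+1]C[k+1] r k)

pascalSplit : ∀ r k → Fin (suc r C suc k) → Fin (r C k) ⊎ Fin (r C suc k)
pascalSplit r k i = splitAt (r C k) (cast (pascal r k) i)

pascalJoin : ∀ r k → Fin (r C k) ⊎ Fin (r C suc k) → Fin (suc r C suc k)
pascalJoin r k x = cast (sym (pascal r k)) (join (r C k) (r C suc k) x)

pascalSplit-join : ∀ r k x → pascalSplit r k (pascalJoin r k x) ≡ x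
pascalSplit-join r k x = begin
  splitAt (r C k) (cast (pascal r k) (cast (sym (pascal r k)) (join _ _ x)))
    ≡⟨ cong (splitAt (r C k)) (cast-involutive (pascal r k) (sym (pascal r k)) _) ⟩
  splitAt (r C k) (join _ _ x)
    ≡⟨ splitAt-join _ _ x ⟩
  x ∎
  where open ≡-Reasoning

mutual
  kSubset : ∀ r k → Fin (r C k) → Subset r
  kSubset r       zero    _ = ⊥
  kSubset zero    (suc k) ()
  kSubset (suc r) (suc k) i = kSubset⁺ r k (pascalSplit r k i)

  kSubset⁺ : ∀ r k → Fin (r C k) ⊎ Fin (r C suc k) → Subset (suc r)
  kSubset⁺ r k (inj₁ i) = inside  ∷ kSubset r k i
  kSubset⁺ r k (inj₂ i) = outside ∷ kSubset r (suc k) i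

∣kSubset∣ : ∀ r k i → ∣ kSubset r k i ∣ ≡ k
∣kSubset∣ r       zero    _ = ∣⊥∣≡0 r
∣kSubset∣ (suc r) (suc k) i with pascalSplit r k i
... | inj₁ j = cong suc (∣kSubset∣ r k j)
... | inj₂ j = ∣kSubset∣ r (suc k) j

kSubset-surjective : ∀ {r k} (S : Subset r) → ∣ S ∣ ≡ k → ∃[ i ] kSubset r k i ≡ S
kSubset-surjective {k = zero} S ∣S∣≡0 = F.zero , sym (∣p∣≡0⇒p≡⊥ S ∣S∣≡0)
kSubset-surjective {suc r} {suc k} (inside ∷ S) ∣S∣≡1+k with kSubset-surjective S (suc-injective ∣S∣≡1+k)
... | i , refl = pascalJoin r k (inj₁ i) , cong (kSubset⁺ r k) (pascalSplit-join r k (inj₁ i))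
kSubset-surjective {suc r} {suc k} (outside ∷ S) ∣S∣≡1+k with kSubset-surjective S ∣S∣≡1+k
... | i , refl = pascalJoin r k (inj₂ i) , cong (kSubset⁺ r k) (pascalSplit-join r k (inj₂ i))

leftColouring : ∀ {r k n m} (σ : Fin n → Subset r) → (∀ a → ∣ σ a ∣ ≡ k) → Colouring r k n m
leftColouring σ ∣σ∣≡k = record { col = λ a _ → σ a ; size = λ a _ → ∣σ∣≡k a }

module _ {n m} (H : Subgraph n m) where

  HasEdge : Set
  HasEdge = ∃[ a ] ∃[ b ] e H a b ≡ true

  path-left-right⇒edge : ∀ {a b} → Star (Adj H) (inj₁ a) (inj₂ b) → ∃[ b′ ] e H a b′ ≡ true
  path-left-right⇒edge (_◅_ {j = inj₂ b′} ab′ _) = b′ , ab′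

  edgeless-path-left-left : ¬ HasEdge → ∀ {a a′} → Star (Adj H) (inj₁ a) (inj₁ a′) → a ≡ a′
  edgeless-path-left-left _      ε                       = refl
  edgeless-path-left-left noEdge (_◅_ {j = inj₂ b} ab _) = contradiction (_ , b , ab) noEdge

connected-monochromatic⇒shape :
  ∀ {r k n m} (σ : Fin n → Subset r) (∣σ∣≡k : ∀ a → ∣ σ a ∣ ≡ k) (H : Subgraph n m) →
  Connected H → Monochromatic (leftColouring σ ∣σ∣≡k) H →
  ∃[ s ] ∀ a → vL H a ≡ true → s covers σ a
connected-monochromatic⇒shape σ _ H conn (c , mono)
  with any? (λ a → any? (λ b → e H a b ≟ᵇ true)) | any? (λ a → vL H a ≟ᵇ true)
... | yes (a₀ , b₀ , a₀b₀) | _ = inj₁ c , λ a a∈H →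
  let b , ab = path-left-right⇒edge H (conn (inj₁ a) (inj₂ b₀) a∈H (proj₂ (closed H a₀ b₀ a₀b₀)))
  in  mono a b ab
... | no noEdge | yes (a₀ , a₀∈H) = inj₂ (σ a₀) , λ a a∈H →
  cong σ (edgeless-path-left-left H noEdge (conn (inj₁ a₀) (inj₁ a) a₀∈H a∈H))
... | no _ | no noLeft = inj₂ ⊥ , λ a a∈H → contradiction (a , a∈H) noLeft

leftColouring-tcAtLeast : ∀ {r k n m} (σ : Fin n → Subset r) (∣σ∣≡1+k : ∀ a → ∣ σ a ∣ ≡ suc k) →
                   (∀ S → ∣ S ∣ ≡ suc k → ∃[ a ] σ a ≡ S) → k < r →
                   TcAtLeast {m = m} (leftColouring σ ∣σ∣≡1+k) (r ∸ suc k + 1)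
leftColouring-tcAtLeast {r} {k} σ ∣σ∣≡1+k σ-surjective k<r t T trees covering = begin
  r ∸ suc k + 1     ≡⟨ +-comm _ 1 ⟩
  suc (r ∸ suc k)   ≡⟨ +-∸-assoc 1 k<r ⟨
  r ∸ k             ≤⟨ m≤n+o⇒m∸n≤o r k (≤-trans r≤t+k (≤-reflexive (+-comm t k))) ⟩
  t                 ∎
  where
  open ≤-Reasoning
  shapeOf : ∀ j → ∃[ s ] ∀ a → vL (T j) a ≡ true → s covers σ a
  shapeOf j = connected-monochromatic⇒shape σ ∣σ∣≡1+k (T j) (proj₁ (proj₂ (proj₁ (trees j)))) (proj₂ (trees j))
  shape : Fin t → Shape r
  shape = proj₁ ∘ shapeOf
  coversAll : CoversAll (suc k) (tabulate shape)
  coversAll S ∣S∣≡1+k with σ-surjective S ∣S∣≡1+k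
  ... | a , refl with covering (inj₁ a)
  ...   | j , a∈Tj = tabulate⁺ j (proj₂ (shapeOf j) a a∈Tj)
  r≤t+k : r ≤ t + k
  r≤t+k = subst (λ l → r ≤ l + k) (length-tabulate shape) (coversAll⇒≤length+k _ k<r coversAll)

lemma4p1 : (r k m : ℕ) → 1 ≤ k → 1 ≤ m → k < r →
    ∃[ φ ] TcAtLeast {r} {k} {r C k} {m} φ (r ∸ k + 1)
lemma4p1 r (suc k) m _ _ 1+k<r =
  leftColouring (kSubset r (suc k)) (∣kSubset∣ r (suc k)) ,
  leftColouring-tcAtLeast (kSubset r (suc k)) (∣kSubset∣ r (suc k)) kSubset-surjective (<⇒≤ 1+k<r)
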